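{- Let $T$ be a finite tree of order $n \ge 4$ that has a redundant identifying code. Then $\mathrm{RED{:}IC}(T) = n$ if and only if every vertex $v \in V(T)$ satisfies at least one of the following: (1) $v$ is a leaf; (2) $v$ is a support vertex; (3) $v$ is adjacent to a support vertex of degree $3$; (4) there is a path $v w u$ in $T$ (with $w$ adjacent to both $v$ and $u$, $u \ne v$) such that $\deg(w) = \deg(u) = 2$.
   Context: $N[v]$ denotes the closed neighborhood of $v$ and $\Delta$ symmetric difference. A set $S \subseteq V(T)$ is a redundant identifying code if every vertex $v$ satisfies $|N[v] \cap S| \ge 2$ and every pair of distinct vertices $u,v$ satisfies $|(N[u]\cap S)\,\Delta\,(N[v]\cap S)| \ge 2$; $\mathrm{RED{:}IC}(T)$ is the minimum cardinality of such a set. A vertex $u$ with exactly one neighbor $v$ is a leaf, and $v$ is then a support vertex. -}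

module Defs where

open import Data.Nat using (ℕ; _≤_)
open import Data.Bool using (Bool; true; false; _∨_; T)
open import Data.Fin using (Fin; _≟_)
open import Data.Fin.Subset using (Subset; _∩_; _∪_; _─_; ∣_∣; ⁅_⁆)
open import Data.Vec using (tabulate)
open import Data.List using (List; []; _∷_; length; _∷ʳ_)
open import Data.List.Relation.Unary.Unique.Propositional using (Unique)
open import Data.List.Relation.Unary.Linked using (Linked)
open import Data.Product using (Σ; ∃; ∃-syntax; _×_)
open import Data.Empty using (⊥)
open import Data.Sum using (_⊎_)
open import Relation.Nullary using (¬_; does)
open import Relation.Binary.PropositionalEquality using (_≡_; _≢_)

record Graph (n : ℕ) : Set where
  field
    adj    : Fin n → Fin n → Bool
    sym    : ∀ u v → adj u v ≡ adj v u
    irrefl : ∀ v → adj v v ≡ false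

module _ {n : ℕ} (G : Graph n) where
  open Graph G

  Adj : Fin n → Fin n → Set
  Adj u v = T (adj u v)

  data Walk : Fin n → Fin n → Set where
    []  : ∀ {u} → Walk u u
    _∷_ : ∀ {u w v} → Adj u w → Walk w v → Walk u v

  Connected : Set
  Connected = ∀ u v → Walk u v

  IsCycle : List (Fin n) → Set
  IsCycle [] = ⊥
  IsCycle (v ∷ vs) = 2 ≤ length vs × Unique (v ∷ vs) × Linked Adj ((v ∷ vs) ∷ʳ v)

  Acyclic : Set
  Acyclic = ∀ vs → ¬ IsCycle vs

  IsTree : Set
  IsTree = Connected × Acyclic

  N : Fin n → Subset n
  N v = tabulate (λ u → adj v u)

  N[_] : Fin n → Subset n
  N[ v ] = tabulate (λ u → does (u ≟ v) ∨ adj v u)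

  deg : Fin n → ℕ
  deg v = ∣ N v ∣

  IsLeaf : Fin n → Set
  IsLeaf v = deg v ≡ 1

  IsSupport : Fin n → Set
  IsSupport v = ∃[ u ] (Adj v u × IsLeaf u)

  _Δ_ : Subset n → Subset n → Subset n
  A Δ B = (A ─ B) ∪ (B ─ A)

  IsRedIC : Subset n → Set
  IsRedIC S =
    (∀ v → 2 ≤ ∣ N[ v ] ∩ S ∣) ×
    (∀ u v → u ≢ v → 2 ≤ ∣ (N[ u ] ∩ S) Δ (N[ v ] ∩ S) ∣)

  HasRedIC : Set
  HasRedIC = ∃[ S ] IsRedIC S

  REDIC≡ : ℕ → Set
  REDIC≡ k = (∃[ S ] (IsRedIC S × ∣ S ∣ ≡ k)) × (∀ S → IsRedIC S → k ≤ ∣ S ∣)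

  VertexCondition : Fin n → Set
  VertexCondition v =
    IsLeaf v ⊎ (IsSupport v ⊎ ((∃[ s ] (Adj v s × IsSupport s × deg s ≡ 3)) ⊎
      (∃[ w ] ∃[ u ] (Adj v w × Adj w u × u ≢ v × deg w ≡ 2 × deg u ≡ 2))))

-- A superset of a redundant identifying code is again one, so RED:IC(T) = n
-- exactly when no set V ∖ {x} is a code. Restricting the code conditions to
-- V ∖ {x} just deletes x from the sets they count: a closed neighbourhood
-- N[w] ∋ x falls below two elements iff w is a leaf, and a symmetric difference
-- N[u] Δ N[v] ∋ x iff it had exactly two elements. Without triangles and 4-cycles
-- the latter pins x down: for non-adjacent u, v it forces N(u) ⊆ N(v), so the
-- vertex x ∈ {u, v} is a leaf; for adjacent u, v with x ∈ N(u), either v is a leaf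
-- and deg u = 3, or x u v is a path with deg u = deg v = 2. Conversely each of the
-- four conditions exhibits such a w or such a pair u, v.
module Submission where

open import Defs using (Graph; IsTree; HasRedIC; REDIC≡; VertexCondition)
import Defs as D
open import Data.Bool using (Bool; T; _∨_)
open import Data.Bool.Properties using (T-≡)
open import Data.Unit using (tt)
open import Data.Fin using (Fin; zero; suc; _≟_)
open import Data.Fin.Properties using (all?; ¬∀⟶∃¬; ∀-cons)
open import Data.Fin.Subset
  using (Subset; _∈_; _∉_; _⊆_; _∩_; _∪_; _─_; _-_; ∣_∣; ⊤; ⁅_⁆; Empty; inside; outside)
open import Data.Fin.Subset.Properties
open import Data.List using ([]; _∷_)
open import Data.List.Relation.Unary.All using ([]; _∷_)
open import Data.List.Relation.Unary.AllPairs using ([]; _∷_)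
open import Data.List.Relation.Unary.Linked using ([-]; _∷_)
open import Data.Nat using (ℕ; zero; suc; _≤_; _<_; z≤n; s≤s)
open import Data.Nat.Properties using (≤-trans; ≤-antisym; ≤-reflexive; suc-injective; <⇒≱; 1+n≰n)
open import Data.Product using (∃; _×_; _,_; proj₁; proj₂)
open import Data.Sum using (_⊎_; inj₁; inj₂; [_,_])
import Data.Sum as Sum
import Data.Product as Product
open import Data.Vec using (_∷_; here; there; tabulate)
open import Data.Vec.Properties using (lookup∘tabulate; []=⇒lookup; lookup⇒[]=)
open import Function using (_∘_; id; _⇔_; mk⇔; Equivalence)
open import Relation.Nullary using (¬_; Dec; does; yes; no; contradiction)
open import Relation.Nullary.Decidable using (T?)
open import Relation.Binary.PropositionalEquality
  using (_≡_; _≢_; refl; sym; trans; cong; subst; module ≡-Reasoning)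

module _ where

  private variable
    n k : ℕ
    p q r s : Subset n
    x y : Fin n

  ∀[P⊎Q]⇒∀P⊎Q : ∀ {P : Fin n → Set} {Q : Set} → (∀ i → P i ⊎ Q) → (∀ i → P i) ⊎ Q
  ∀[P⊎Q]⇒∀P⊎Q {zero}  f = inj₁ λ ()
  ∀[P⊎Q]⇒∀P⊎Q {suc n} f with f zero | ∀[P⊎Q]⇒∀P⊎Q (f ∘ suc)
  ... | inj₂ q  | _       = inj₂ q
  ... | inj₁ _  | inj₂ q  = inj₂ q
  ... | inj₁ p₀ | inj₁ ps = inj₁ (∀-cons p₀ ps)

  T[does∨]⁺ : ∀ {A : Set} {b} (a? : Dec A) → A ⊎ T b → T (does a? ∨ b)
  T[does∨]⁺ (yes _)  _        = tt
  T[does∨]⁺ (no ¬a) (inj₁ a) = contradiction a ¬a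
  T[does∨]⁺ (no _)  (inj₂ t) = t

  T[does∨]⁻ : ∀ {A : Set} {b} (a? : Dec A) → T (does a? ∨ b) → A ⊎ T b
  T[does∨]⁻ (yes a) _ = inj₁ a
  T[does∨]⁻ (no _)  t = inj₂ t

  x∈tabulate⁺ : ∀ (f : Fin n → Bool) → T (f x) → x ∈ tabulate f
  x∈tabulate⁺ f t = lookup⇒[]= _ (tabulate f) (trans (lookup∘tabulate f _) (Equivalence.to T-≡ t))

  x∈tabulate⁻ : ∀ (f : Fin n → Bool) → x ∈ tabulate f → T (f x)
  x∈tabulate⁻ f x∈ = Equivalence.from T-≡ (trans (sym (lookup∘tabulate f _)) ([]=⇒lookup x∈))

  x∈p─q⁻ : ∀ (p q : Subset n) → x ∈ p ─ q → x ∈ p × x ∉ q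
  x∈p─q⁻ p q x∈p─q = p─q⊆p p q x∈p─q , x∉q p q x∈p─q
    where
    x∉q : ∀ (p q : Subset n) → x ∈ p ─ q → x ∉ q
    x∉q (_ ∷ p) (inside  ∷ q) (there x∈p─q) (there x∈q) = x∉q p q x∈p─q x∈q
    x∉q (_ ∷ p) (outside ∷ q) (there x∈p─q) (there x∈q) = x∉q p q x∈p─q x∈q

  x∈p-y⁻ : x ∈ p - y → x ∈ p × x ≢ y
  x∈p-y⁻ {p = p} {y = y} x∈p-y = Product.map₂ x∉⁅y⁆⇒x≢y (x∈p─q⁻ p ⁅ y ⁆ x∈p-y)

  x∉p⇒p⊆q-x : x ∉ p → p ⊆ q → p ⊆ q - x
  x∉p⇒p⊆q-x x∉p p⊆q y∈p = x∈p∧x≢y⇒x∈p-y (p⊆q y∈p) λ { refl → x∉p y∈p }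

  Empty[p-x]⇒p⊆⁅x⁆ : Empty (p - x) → p ⊆ ⁅ x ⁆
  Empty[p-x]⇒p⊆⁅x⁆ {x = x} empty {y} y∈p with y ≟ x
  ... | yes refl = x∈⁅x⁆ x
  ... | no y≢x   = contradiction (y , x∈p∧x≢y⇒x∈p-y y∈p y≢x) empty

  p∩[⊤-x]≡p-x : ∀ (p : Subset n) x → p ∩ (⊤ - x) ≡ p - x
  p∩[⊤-x]≡p-x p x = ⊆-antisym forth back
    where
    forth : p ∩ (⊤ - x) ⊆ p - x
    forth y∈ = let y∈p , y∈⊤-x = x∈p∩q⁻ p (⊤ - x) y∈ in x∈p∧x≢y⇒x∈p-y y∈p (proj₂ (x∈p-y⁻ y∈⊤-x))
    back : p - x ⊆ p ∩ (⊤ - x)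
    back y∈ = let y∈p , y≢x = x∈p-y⁻ y∈ in x∈p∩q⁺ (y∈p , x∈p∧x≢y⇒x∈p-y ∈⊤ y≢x)

  ∣p∣≡1+∣p-x∣ : x ∈ p → ∣ p ∣ ≡ suc ∣ p - x ∣
  ∣p∣≡1+∣p-x∣ {p = inside  ∷ p} here        = cong (suc ∘ ∣_∣) (sym (p─⊥≡p p))
  ∣p∣≡1+∣p-x∣ {p = inside  ∷ p} (there x∈p) = cong suc (∣p∣≡1+∣p-x∣ x∈p)
  ∣p∣≡1+∣p-x∣ {p = outside ∷ p} (there x∈p) = ∣p∣≡1+∣p-x∣ x∈p

  ∣p∣≡1+k⇒∣p-x∣≡k : x ∈ p → ∣ p ∣ ≡ suc k → ∣ p - x ∣ ≡ k
  ∣p∣≡1+k⇒∣p-x∣≡k x∈p ∣p∣≡1+k = suc-injective (trans (sym (∣p∣≡1+∣p-x∣ x∈p)) ∣p∣≡1+k)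

  x∈p⇒0<∣p∣ : x ∈ p → 0 < ∣ p ∣
  x∈p⇒0<∣p∣ x∈p = subst (0 <_) (sym (∣p∣≡1+∣p-x∣ x∈p)) (s≤s z≤n)

  ∣p∣≤1⇒x≡y : ∣ p ∣ ≤ 1 → x ∈ p → y ∈ p → x ≡ y
  ∣p∣≤1⇒x≡y {p = p} {x = x} {y} ∣p∣≤1 x∈p y∈p with x ≟ y
  ... | yes x≡y = x≡y
  ... | no x≢y  = contradiction ∣p∣≤1 (<⇒≱ 1<∣p∣)
    where
    1<∣p∣ : 1 < ∣ p ∣
    1<∣p∣ = subst (1 <_) (sym (∣p∣≡1+∣p-x∣ x∈p))
                  (s≤s (x∈p⇒0<∣p∣ (x∈p∧x≢y⇒x∈p-y y∈p (x≢y ∘ sym))))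

  x∈p⊆q∧∣q∣≡1⇒∣p∣≡1 : x ∈ p → p ⊆ q → ∣ q ∣ ≡ 1 → ∣ p ∣ ≡ 1
  x∈p⊆q∧∣q∣≡1⇒∣p∣≡1 x∈p p⊆q ∣q∣≡1 =
    ≤-antisym (≤-trans (p⊆q⇒∣p∣≤∣q∣ p⊆q) (≤-reflexive ∣q∣≡1)) (x∈p⇒0<∣p∣ x∈p)

  2≤∣p-x∣⊎∣p∣≡2 : x ∈ p → 2 ≤ ∣ p ∣ → 2 ≤ ∣ p - x ∣ ⊎ ∣ p ∣ ≡ 2
  2≤∣p-x∣⊎∣p∣≡2 {x = x} {p = p} x∈p 2≤∣p∣ with ∣ p - x ∣ | ∣p∣≡1+∣p-x∣ x∈p
  ... | suc (suc _) | _            = inj₁ (s≤s (s≤s z≤n))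
  ... | 1           | ∣p∣≡2        = inj₂ ∣p∣≡2
  ... | 0           | ∣p∣≡1        = contradiction (subst (2 ≤_) ∣p∣≡1 2≤∣p∣) 1+n≰n

  infixl 6 _⊖_

  -- Defs' _Δ_ takes the graph as an unused parameter: _Δ_ G p q unfolds to p ⊖ q.
  _⊖_ : Subset n → Subset n → Subset n
  p ⊖ q = (p ─ q) ∪ (q ─ p)

  x∈p⊖q⁻ : ∀ (p q : Subset n) → x ∈ p ⊖ q → x ∈ p × x ∉ q ⊎ x ∈ q × x ∉ p
  x∈p⊖q⁻ p q = Sum.map (x∈p─q⁻ p q) (x∈p─q⁻ q p) ∘ x∈p∪q⁻ (p ─ q) (q ─ p)

  x∈p⊖q⁺ : x ∈ p × x ∉ q ⊎ x ∈ q × x ∉ p → x ∈ p ⊖ q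
  x∈p⊖q⁺ = x∈p∪q⁺ ∘ Sum.map (λ (x∈p , x∉q) → x∈p∧x∉q⇒x∈p─q x∈p x∉q)
                            (λ (x∈q , x∉p) → x∈p∧x∉q⇒x∈p─q x∈q x∉p)

  ⊖-comm : ∀ (p q : Subset n) → p ⊖ q ≡ q ⊖ p
  ⊖-comm p q = ∪-comm (p ─ q) (q ─ p)

  ⊖-distribʳ-∩ : ∀ (p q r : Subset n) → (p ∩ r) ⊖ (q ∩ r) ≡ (p ⊖ q) ∩ r
  ⊖-distribʳ-∩ p q r = ⊆-antisym forth back
    where
    forth : (p ∩ r) ⊖ (q ∩ r) ⊆ (p ⊖ q) ∩ r
    forth y∈ with x∈p⊖q⁻ (p ∩ r) (q ∩ r) y∈
    ... | inj₁ (y∈p∩r , y∉q∩r) = let y∈p , y∈r = x∈p∩q⁻ p r y∈p∩r in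
      x∈p∩q⁺ (x∈p⊖q⁺ (inj₁ (y∈p , λ y∈q → y∉q∩r (x∈p∩q⁺ (y∈q , y∈r)))) , y∈r)
    ... | inj₂ (y∈q∩r , y∉p∩r) = let y∈q , y∈r = x∈p∩q⁻ q r y∈q∩r in
      x∈p∩q⁺ (x∈p⊖q⁺ (inj₂ (y∈q , λ y∈p → y∉p∩r (x∈p∩q⁺ (y∈p , y∈r)))) , y∈r)
    back : (p ⊖ q) ∩ r ⊆ (p ∩ r) ⊖ (q ∩ r)
    back y∈ with x∈p∩q⁻ (p ⊖ q) r y∈
    ... | y∈p⊖q , y∈r with x∈p⊖q⁻ p q y∈p⊖q
    ...   | inj₁ (y∈p , y∉q) = x∈p⊖q⁺ (inj₁ (x∈p∩q⁺ (y∈p , y∈r) , y∉q ∘ proj₁ ∘ x∈p∩q⁻ q r))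
    ...   | inj₂ (y∈q , y∉p) = x∈p⊖q⁺ (inj₂ (x∈p∩q⁺ (y∈q , y∈r) , y∉p ∘ proj₁ ∘ x∈p∩q⁻ p r))

  ∩-monoʳ-⊆ : ∀ (p : Subset n) → q ⊆ r → p ∩ q ⊆ p ∩ r
  ∩-monoʳ-⊆ p q⊆r y∈ = let y∈p , y∈q = x∈p∩q⁻ p _ y∈ in x∈p∩q⁺ (y∈p , q⊆r y∈q)

  ⊖-∩-monoʳ-⊆ : ∀ (p q : Subset n) → r ⊆ s → (p ∩ r) ⊖ (q ∩ r) ⊆ (p ∩ s) ⊖ (q ∩ s)
  ⊖-∩-monoʳ-⊆ {r = r} {s = s} p q r⊆s
    rewrite ⊖-distribʳ-∩ p q r | ⊖-distribʳ-∩ p q s = ∩-monoʳ-⊆ (p ⊖ q) r⊆s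

module _ {n : ℕ} (G : Graph n) where

  private
    Adj : Fin n → Fin n → Set
    Adj = D.Adj G
    N : Fin n → Subset n
    N = D.N G
    N[_] : Fin n → Subset n
    N[_] = D.N[_] G
    deg : Fin n → ℕ
    deg = D.deg G
    IsLeaf : Fin n → Set
    IsLeaf = D.IsLeaf G
    IsRedIC : Subset n → Set
    IsRedIC = D.IsRedIC G

    variable
      a b c d s u v w x y z : Fin n
      S S′ : Subset n

  Adj-sym : Adj u v → Adj v u
  Adj-sym {u} {v} = subst T (Graph.sym G u v)

  Adj⇒≢ : Adj u v → u ≢ v
  Adj⇒≢ {u} uu refl = subst T (Graph.irrefl G u) uu

  ∈N⁺ : Adj v u → u ∈ N v
  ∈N⁺ {v} = x∈tabulate⁺ (Graph.adj G v)

  ∈N⁻ : u ∈ N v → Adj v u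
  ∈N⁻ {v = v} = x∈tabulate⁻ (Graph.adj G v)

  ∈N[]⁺ : u ≡ v ⊎ Adj v u → u ∈ N[ v ]
  ∈N[]⁺ {u = u} {v = v} = x∈tabulate⁺ _ ∘ T[does∨]⁺ (u ≟ v)

  ∈N[]⁻ : u ∈ N[ v ] → u ≡ v ⊎ Adj v u
  ∈N[]⁻ {u = u} {v = v} = T[does∨]⁻ (u ≟ v) ∘ x∈tabulate⁻ _

  v∈N[v] : v ∈ N[ v ]
  v∈N[v] = ∈N[]⁺ (inj₁ refl)

  Adj⇒∈N[] : Adj v u → u ∈ N[ v ]
  Adj⇒∈N[] = ∈N[]⁺ ∘ inj₂

  ¬Adj⇒∉N[] : ¬ Adj v u → u ≢ v → u ∉ N[ v ]
  ¬Adj⇒∉N[] ¬vu u≢v = [ u≢v , ¬vu ] ∘ ∈N[]⁻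

  N[v]-v≡Nv : N[ v ] - v ≡ N v
  N[v]-v≡Nv = ⊆-antisym forth back
    where
    forth : N[ v ] - v ⊆ N v
    forth u∈ = let u∈N[v] , u≢v = x∈p-y⁻ u∈ in
      ∈N⁺ ([ (λ u≡v → contradiction u≡v u≢v) , id ] (∈N[]⁻ u∈N[v]))
    back : N v ⊆ N[ v ] - v
    back u∈ = x∈p∧x≢y⇒x∈p-y (Adj⇒∈N[] (∈N⁻ u∈)) (Adj⇒≢ (∈N⁻ u∈) ∘ sym)

  ∣N[v]∣≡1+deg : ∣ N[ v ] ∣ ≡ suc (deg v)
  ∣N[v]∣≡1+deg = trans (∣p∣≡1+∣p-x∣ v∈N[v]) (cong (suc ∘ ∣_∣) N[v]-v≡Nv)

  ∣N[w]-x∣≡deg : x ∈ N[ w ] → ∣ N[ w ] - x ∣ ≡ deg w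
  ∣N[w]-x∣≡deg x∈ = ∣p∣≡1+k⇒∣p-x∣≡k x∈ ∣N[v]∣≡1+deg

  leaf-neighbour-unique : IsLeaf v → Adj v u → Adj v w → w ≡ u
  leaf-neighbour-unique leaf vu vw = ∣p∣≤1⇒x≡y (≤-reflexive leaf) (∈N⁺ vw) (∈N⁺ vu)

  exclusive-neighbour : Adj a b → y ∈ N[ a ] → y ∉ N[ b ] → Adj a y × y ≢ b
  exclusive-neighbour ab y∈N[a] y∉N[b] with ∈N[]⁻ y∈N[a]
  ... | inj₁ refl = contradiction (Adj⇒∈N[] (Adj-sym ab)) y∉N[b]
  ... | inj₂ ay   = ay , λ { refl → y∉N[b] v∈N[v] }

  N[u]⊖N[v]≡Nu-v : Adj u v → IsLeaf v → N[ u ] ⊖ N[ v ] ≡ N u - v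
  N[u]⊖N[v]≡Nu-v {u} {v} uv leaf-v = ⊆-antisym forth back
    where
    forth : N[ u ] ⊖ N[ v ] ⊆ N u - v
    forth y∈ with x∈p⊖q⁻ N[ u ] N[ v ] y∈
    ... | inj₁ (y∈N[u] , y∉N[v]) = let uy , y≢v = exclusive-neighbour uv y∈N[u] y∉N[v] in
      x∈p∧x≢y⇒x∈p-y (∈N⁺ uy) y≢v
    ... | inj₂ (y∈N[v] , y∉N[u]) with ∈N[]⁻ y∈N[v]
    ...   | inj₁ refl = contradiction (Adj⇒∈N[] uv) y∉N[u]
    ...   | inj₂ vy with leaf-neighbour-unique leaf-v (Adj-sym uv) vy
    ...     | refl = contradiction v∈N[v] y∉N[u]
    back : N u - v ⊆ N[ u ] ⊖ N[ v ]
    back {y} y∈ with x∈p-y⁻ y∈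
    ... | y∈Nu , y≢v = x∈p⊖q⁺ (inj₁ (Adj⇒∈N[] uy , [ y≢v , v-only-sees-u ] ∘ ∈N[]⁻))
      where
      uy : Adj u y
      uy = ∈N⁻ y∈Nu
      v-only-sees-u : ¬ Adj v y
      v-only-sees-u = Adj⇒≢ uy ∘ sym ∘ leaf-neighbour-unique leaf-v (Adj-sym uv)

  IsRedIC-mono : S ⊆ S′ → IsRedIC S → IsRedIC S′
  IsRedIC-mono S⊆S′ (dominated , separated) =
    (λ v → ≤-trans (dominated v) (p⊆q⇒∣p∣≤∣q∣ (∩-monoʳ-⊆ N[ v ] S⊆S′))) ,
    (λ u v u≢v → ≤-trans (separated u v u≢v) (p⊆q⇒∣p∣≤∣q∣ (⊖-∩-monoʳ-⊆ N[ u ] N[ v ] S⊆S′)))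

  IsRedIC-⊤⁻ : IsRedIC ⊤ → (∀ v → 2 ≤ ∣ N[ v ] ∣) × (∀ u v → u ≢ v → 2 ≤ ∣ N[ u ] ⊖ N[ v ] ∣)
  IsRedIC-⊤⁻ = Product.map
    (λ dominated v → subst (2 ≤_) (cong ∣_∣ (∩-identityʳ N[ v ])) (dominated v))
    (λ separated u v u≢v → subst (2 ≤_) (cong ∣_∣ (trans (⊖-distribʳ-∩ N[ u ] N[ v ] ⊤) (∩-identityʳ _)))
                                 (separated u v u≢v))

  IsRedIC[⊤-x]⇔ : IsRedIC (⊤ - x) ⇔
    ((∀ v → 2 ≤ ∣ N[ v ] - x ∣) × (∀ u v → u ≢ v → 2 ≤ ∣ (N[ u ] ⊖ N[ v ]) - x ∣))
  IsRedIC[⊤-x]⇔ {x} = mk⇔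
    (Product.map (λ dom v → subst (2 ≤_) (∣N[v]∩S∣≡ v) (dom v))
                 (λ sep u v u≢v → subst (2 ≤_) (∣Δ∩S∣≡ u v) (sep u v u≢v)))
    (Product.map (λ dom v → subst (2 ≤_) (sym (∣N[v]∩S∣≡ v)) (dom v))
                 (λ sep u v u≢v → subst (2 ≤_) (sym (∣Δ∩S∣≡ u v)) (sep u v u≢v)))
    where
    ∣N[v]∩S∣≡ : ∀ v → ∣ N[ v ] ∩ (⊤ - x) ∣ ≡ ∣ N[ v ] - x ∣
    ∣N[v]∩S∣≡ v = cong ∣_∣ (p∩[⊤-x]≡p-x N[ v ] x)
    ∣Δ∩S∣≡ : ∀ u v → ∣ (N[ u ] ∩ (⊤ - x)) ⊖ (N[ v ] ∩ (⊤ - x)) ∣ ≡ ∣ (N[ u ] ⊖ N[ v ]) - x ∣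
    ∣Δ∩S∣≡ u v = cong ∣_∣ (trans (⊖-distribʳ-∩ N[ u ] N[ v ] (⊤ - x)) (p∩[⊤-x]≡p-x _ x))

  undominated : IsLeaf w → x ∈ N[ w ] → ¬ IsRedIC (⊤ - x)
  undominated {w} leaf-w x∈N[w] code =
    1+n≰n (subst (2 ≤_) (trans (∣N[w]-x∣≡deg x∈N[w]) leaf-w) (proj₁ (Equivalence.to IsRedIC[⊤-x]⇔ code) w))

  unseparated : u ≢ v → ∣ (N[ u ] ⊖ N[ v ]) - x ∣ ≤ 1 → ¬ IsRedIC (⊤ - x)
  unseparated {u} {v} u≢v ∣Δ-x∣≤1 code =
    1+n≰n (≤-trans (proj₂ (Equivalence.to IsRedIC[⊤-x]⇔ code) u v u≢v) ∣Δ-x∣≤1)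

  ∣[N[s]⊖N[u]]-x∣≤1 : Adj s u → IsLeaf u → deg s ≡ 3 → Adj s x → x ≢ u →
                      ∣ (N[ s ] ⊖ N[ u ]) - x ∣ ≤ 1
  ∣[N[s]⊖N[u]]-x∣≤1 {s} {u} {x} su leaf-u deg-s sx x≢u =
    ≤-trans (p⊆q⇒∣p∣≤∣q∣ forth)
            (≤-reflexive (∣p∣≡1+k⇒∣p-x∣≡k (x∈p∧x≢y⇒x∈p-y (∈N⁺ sx) x≢u) (∣p∣≡1+k⇒∣p-x∣≡k (∈N⁺ su) deg-s)))
    where
    forth : (N[ s ] ⊖ N[ u ]) - x ⊆ N s - u - x
    forth y∈ with x∈p-y⁻ y∈
    ... | y∈Δ , y≢x with x∈p⊖q⁻ N[ s ] N[ u ] y∈Δ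
    ...   | inj₁ (y∈N[s] , y∉N[u]) = let sy , y≢u = exclusive-neighbour su y∈N[s] y∉N[u] in
      x∈p∧x≢y⇒x∈p-y (x∈p∧x≢y⇒x∈p-y (∈N⁺ sy) y≢u) y≢x
    ...   | inj₂ (y∈N[u] , y∉N[s]) = let uy , y≢s = exclusive-neighbour (Adj-sym su) y∈N[u] y∉N[s] in
      contradiction (leaf-neighbour-unique leaf-u (Adj-sym su) uy) y≢s

  ∣[N[w]⊖N[u]]-x∣≤1 : Adj x w → Adj w u → u ≢ x → deg w ≡ 2 → deg u ≡ 2 →
                      ∣ (N[ w ] ⊖ N[ u ]) - x ∣ ≤ 1
  ∣[N[w]⊖N[u]]-x∣≤1 {x} {w} {u} xw wu u≢x deg-w deg-u =
    ≤-trans (p⊆q⇒∣p∣≤∣q∣ forth) (≤-reflexive (∣p∣≡1+k⇒∣p-x∣≡k (∈N⁺ (Adj-sym wu)) deg-u))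
    where
    ∣Nw-x∣≡1 : ∣ N w - x ∣ ≡ 1
    ∣Nw-x∣≡1 = ∣p∣≡1+k⇒∣p-x∣≡k (∈N⁺ (Adj-sym xw)) deg-w
    forth : (N[ w ] ⊖ N[ u ]) - x ⊆ N u - w
    forth y∈ with x∈p-y⁻ y∈
    ... | y∈Δ , y≢x with x∈p⊖q⁻ N[ w ] N[ u ] y∈Δ
    ...   | inj₁ (y∈N[w] , y∉N[u]) = let wy , y≢u = exclusive-neighbour wu y∈N[w] y∉N[u] in
      contradiction (∣p∣≤1⇒x≡y (≤-reflexive ∣Nw-x∣≡1) (x∈p∧x≢y⇒x∈p-y (∈N⁺ wy) y≢x)
                                                     (x∈p∧x≢y⇒x∈p-y (∈N⁺ wu) u≢x)) y≢u
    ...   | inj₂ (y∈N[u] , y∉N[w]) = let uy , y≢w = exclusive-neighbour (Adj-sym wu) y∈N[u] y∉N[w] in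
      x∈p∧x≢y⇒x∈p-y (∈N⁺ uy) y≢w

  VertexCondition⇒¬IsRedIC[⊤-x] : VertexCondition G x → ¬ IsRedIC (⊤ - x)
  VertexCondition⇒¬IsRedIC[⊤-x] (inj₁ leaf-x) = undominated leaf-x v∈N[v]
  VertexCondition⇒¬IsRedIC[⊤-x] (inj₂ (inj₁ (u , xu , leaf-u))) = undominated leaf-u (Adj⇒∈N[] (Adj-sym xu))
  VertexCondition⇒¬IsRedIC[⊤-x] {x} (inj₂ (inj₂ (inj₁ (s , xs , (u , su , leaf-u) , deg-s)))) with x ≟ u
  ... | yes refl = undominated leaf-u v∈N[v]
  ... | no x≢u   = unseparated (Adj⇒≢ su) (∣[N[s]⊖N[u]]-x∣≤1 su leaf-u deg-s (Adj-sym xs) x≢u)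
  VertexCondition⇒¬IsRedIC[⊤-x] (inj₂ (inj₂ (inj₂ (w , u , xw , wu , u≢x , deg-w , deg-u)))) =
    unseparated (Adj⇒≢ wu) (∣[N[w]⊖N[u]]-x∣≤1 xw wu u≢x deg-w deg-u)

  has-neighbour : 2 ≤ ∣ N[ u ] ∣ → ∃ (Adj u)
  has-neighbour {u} 2≤∣N[u]∣ with nonempty? (N u)
  ... | yes (y , y∈Nu) = y , ∈N⁻ y∈Nu
  ... | no Nu-empty    = contradiction (subst (2 ≤_) ∣N[u]∣≡1 2≤∣N[u]∣) 1+n≰n
    where
    ∣N[u]∣≡1 : ∣ N[ u ] ∣ ≡ 1
    ∣N[u]∣≡1 = trans ∣N[v]∣≡1+deg (cong suc (trans (cong ∣_∣ (Empty-unique Nu-empty)) (∣⊥∣≡0 n)))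

  dominated-or-VertexCondition : 2 ≤ ∣ N[ w ] ∣ → 2 ≤ ∣ N[ w ] - x ∣ ⊎ VertexCondition G x
  dominated-or-VertexCondition {w} {x} 2≤∣N[w]∣ with x ∈? N[ w ]
  ... | no x∉N[w] = inj₁ (≤-trans 2≤∣N[w]∣ (p⊆q⇒∣p∣≤∣q∣ (x∉p⇒p⊆q-x x∉N[w] ⊆-refl)))
  ... | yes x∈N[w] = Sum.map₂ (near-leaf ∘ leaf) (2≤∣p-x∣⊎∣p∣≡2 x∈N[w] 2≤∣N[w]∣)
    where
    leaf : ∣ N[ w ] ∣ ≡ 2 → IsLeaf w
    leaf ∣N[w]∣≡2 = suc-injective (trans (sym ∣N[v]∣≡1+deg) ∣N[w]∣≡2)
    near-leaf : IsLeaf w → VertexCondition G x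
    near-leaf leaf-w = [ (λ { refl → inj₁ leaf-w }) , (λ wx → inj₂ (inj₁ (w , Adj-sym wx , leaf-w))) ]
                       (∈N[]⁻ x∈N[w])

  nonadjacent-difference : ¬ Adj u v → u ≢ v → ∣ N[ u ] ⊖ N[ v ] ∣ ≡ 2 →
                           y ∈ N[ u ] ⊖ N[ v ] → y ≡ u ⊎ y ≡ v
  nonadjacent-difference {u} {v} {y} ¬uv u≢v ∣D∣≡2 y∈D with y ≟ u
  ... | yes y≡u = inj₁ y≡u
  ... | no y≢u  = inj₂ (∣p∣≤1⇒x≡y (≤-reflexive (∣p∣≡1+k⇒∣p-x∣≡k u∈D ∣D∣≡2))
                                  (x∈p∧x≢y⇒x∈p-y y∈D y≢u) (x∈p∧x≢y⇒x∈p-y v∈D (u≢v ∘ sym)))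
    where
    u∈D : u ∈ N[ u ] ⊖ N[ v ]
    u∈D = x∈p⊖q⁺ (inj₁ (v∈N[v] , ¬Adj⇒∉N[] (¬uv ∘ Adj-sym) u≢v))
    v∈D : v ∈ N[ u ] ⊖ N[ v ]
    v∈D = x∈p⊖q⁺ (inj₂ (v∈N[v] , ¬Adj⇒∉N[] ¬uv (u≢v ∘ sym)))

  REDIC≡n⇔∀¬IsRedIC[⊤-x] : IsRedIC ⊤ → REDIC≡ G n ⇔ (∀ x → ¬ IsRedIC (⊤ - x))
  REDIC≡n⇔∀¬IsRedIC[⊤-x] ⊤-code = mk⇔ irremovable minimum
    where
    irremovable : REDIC≡ G n → ∀ x → ¬ IsRedIC (⊤ - x)
    irremovable (_ , minimal) x code = <⇒≱ ∣⊤-x∣<n (minimal (⊤ - x) code)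
      where
      ∣⊤-x∣<n : ∣ ⊤ - x ∣ < n
      ∣⊤-x∣<n = subst (∣ ⊤ - x ∣ <_) (∣⊤∣≡n n) (x∈p⇒∣p-x∣<∣p∣ {p = ⊤} (∈⊤ {x = x}))
    minimum : (∀ x → ¬ IsRedIC (⊤ - x)) → REDIC≡ G n
    minimum irremovable = (⊤ , ⊤-code , ∣⊤∣≡n n) , minimal
      where
      minimal : ∀ S → IsRedIC S → n ≤ ∣ S ∣
      minimal S S-code with all? (_∈? S)
      ... | yes ⊤⊆S  = subst (_≤ ∣ S ∣) (∣⊤∣≡n n) (p⊆q⇒∣p∣≤∣q∣ {p = ⊤} λ {x} _ → ⊤⊆S x)
      ... | no ¬⊤⊆S = let x , x∉S = ¬∀⟶∃¬ n (_∈ S) (_∈? S) ¬⊤⊆S in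
        contradiction (IsRedIC-mono (x∉p⇒p⊆q-x x∉S ⊆⊤) S-code) (irremovable x)

  module _ (acyclic : D.Acyclic G) where

    no-triangle : Adj a b → Adj b c → ¬ Adj c a
    no-triangle {a} {b} {c} ab bc ca = acyclic (a ∷ b ∷ c ∷ [])
      ( s≤s (s≤s z≤n)
      , (Adj⇒≢ ab ∷ Adj⇒≢ ca ∘ sym ∷ []) ∷ (Adj⇒≢ bc ∷ []) ∷ [] ∷ []
      , ab ∷ bc ∷ ca ∷ [-] )

    no-square : a ≢ c → b ≢ d → Adj a b → Adj b c → Adj c d → ¬ Adj d a
    no-square {a} {c} {b} {d} a≢c b≢d ab bc cd da = acyclic (a ∷ b ∷ c ∷ d ∷ [])
      ( s≤s (s≤s z≤n)
      , (Adj⇒≢ ab ∷ a≢c ∷ Adj⇒≢ da ∘ sym ∷ []) ∷ (Adj⇒≢ bc ∷ b≢d ∷ []) ∷ (Adj⇒≢ cd ∷ []) ∷ [] ∷ []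
      , ab ∷ bc ∷ cd ∷ da ∷ [-] )

    neighbour-of-neighbour-∉N[] : Adj u v → Adj v z → z ≢ u → z ∉ N[ u ]
    neighbour-of-neighbour-∉N[] uv vz z≢u = [ z≢u , no-triangle uv vz ∘ Adj-sym ] ∘ ∈N[]⁻

    nonadjacent-pair-leaf : ¬ Adj u v → u ≢ v → 2 ≤ ∣ N[ u ] ∣ → ∣ N[ u ] ⊖ N[ v ] ∣ ≡ 2 → IsLeaf u
    nonadjacent-pair-leaf {u} {v} ¬uv u≢v 2≤∣N[u]∣ ∣D∣≡2 with has-neighbour 2≤∣N[u]∣
    ... | y , uy = x∈p⊆q∧∣q∣≡1⇒∣p∣≡1 (∈N⁺ uy) Nu⊆⁅y⁆ (∣⁅x⁆∣≡1 y)
      where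
      Adj-v : Adj u z → Adj v z
      Adj-v {z} uz with z ∈? N[ v ]
      ... | yes z∈N[v] = [ (λ { refl → contradiction uz ¬uv }) , id ] (∈N[]⁻ z∈N[v])
      ... | no z∉N[v]  = [ (λ { refl → contradiction refl (Adj⇒≢ uz) }) , (λ { refl → contradiction uz ¬uv }) ]
                           (nonadjacent-difference ¬uv u≢v ∣D∣≡2 (x∈p⊖q⁺ (inj₁ (Adj⇒∈N[] uz , z∉N[v]))))
      Nu⊆⁅y⁆ : N u ⊆ ⁅ y ⁆
      Nu⊆⁅y⁆ {z} z∈Nu with z ≟ y
      ... | yes refl = x∈⁅x⁆ z
      ... | no z≢y   = contradiction (Adj-sym (∈N⁻ z∈Nu))
                         (no-square u≢v (z≢y ∘ sym) uy (Adj-sym (Adj-v uy)) (Adj-v (∈N⁻ z∈Nu)))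

    adjacent-pair-deg≡2 : Adj u v → x ∈ N u - v → y ∈ N[ v ] → y ∈ N[ u ] ⊖ N[ v ] →
                          ∣ N[ u ] ⊖ N[ v ] ∣ ≡ 2 → deg u ≡ 2
    adjacent-pair-deg≡2 {u} {v} {x} {y} uv x∈Nu-v y∈N[v] y∈D ∣D∣≡2 =
      trans (∣p∣≡1+∣p-x∣ (∈N⁺ uv)) (cong suc (x∈p⊆q∧∣q∣≡1⇒∣p∣≡1 x∈Nu-v forth (∣p∣≡1+k⇒∣p-x∣≡k y∈D ∣D∣≡2)))
      where
      forth : N u - v ⊆ (N[ u ] ⊖ N[ v ]) - y
      forth {z} z∈ with x∈p-y⁻ z∈
      ... | z∈Nu , z≢v = x∈p∧x≢y⇒x∈p-y (x∈p⊖q⁺ (inj₁ (Adj⇒∈N[] (∈N⁻ z∈Nu) , z∉N[v])))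
                                       (λ { refl → z∉N[v] y∈N[v] })
        where
        z∉N[v] : z ∉ N[ v ]
        z∉N[v] = neighbour-of-neighbour-∉N[] (Adj-sym uv) (∈N⁻ z∈Nu) z≢v

    adjacent-pair : Adj u v → x ∈ N[ u ] → x ∉ N[ v ] → ∣ N[ u ] ⊖ N[ v ] ∣ ≡ 2 → VertexCondition G x
    adjacent-pair {u} {v} {x} uv x∈N[u] x∉N[v] ∣D∣≡2
      with exclusive-neighbour uv x∈N[u] x∉N[v] | nonempty? (N v - u)
    ... | ux , _ | no v-pendant = inj₂ (inj₂ (inj₁ (u , Adj-sym ux , (v , uv , leaf-v) , deg-u≡3)))
      where
      open ≡-Reasoning
      leaf-v : IsLeaf v
      leaf-v = x∈p⊆q∧∣q∣≡1⇒∣p∣≡1 (∈N⁺ (Adj-sym uv)) (Empty[p-x]⇒p⊆⁅x⁆ v-pendant) (∣⁅x⁆∣≡1 u)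
      deg-u≡3 : deg u ≡ 3
      deg-u≡3 = begin
        deg u                   ≡⟨ ∣p∣≡1+∣p-x∣ (∈N⁺ uv) ⟩
        suc ∣ N u - v ∣           ≡⟨ cong (suc ∘ ∣_∣) (N[u]⊖N[v]≡Nu-v uv leaf-v) ⟨
        suc ∣ N[ u ] ⊖ N[ v ] ∣   ≡⟨ cong suc ∣D∣≡2 ⟩
        3                       ∎
    ... | ux , x≢v | yes (y , y∈Nv-u) =
      inj₂ (inj₂ (inj₂ (u , v , Adj-sym ux , uv , x≢v ∘ sym , deg-u≡2 , deg-v≡2)))
      where
      vy : Adj v y
      vy = ∈N⁻ (proj₁ (x∈p-y⁻ y∈Nv-u))
      deg-u≡2 : deg u ≡ 2
      deg-u≡2 = adjacent-pair-deg≡2 uv (x∈p∧x≢y⇒x∈p-y (∈N⁺ ux) x≢v) (Adj⇒∈N[] vy)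
        (x∈p⊖q⁺ (inj₂ (Adj⇒∈N[] vy , neighbour-of-neighbour-∉N[] uv vy (proj₂ (x∈p-y⁻ y∈Nv-u))))) ∣D∣≡2
      deg-v≡2 : deg v ≡ 2
      deg-v≡2 = adjacent-pair-deg≡2 (Adj-sym uv) y∈Nv-u x∈N[u] (x∈p⊖q⁺ (inj₂ (x∈N[u] , x∉N[v])))
        (trans (cong ∣_∣ (⊖-comm N[ v ] N[ u ])) ∣D∣≡2)

    two-differences⇒VertexCondition : u ≢ v → 2 ≤ ∣ N[ u ] ∣ → 2 ≤ ∣ N[ v ] ∣ →
      x ∈ N[ u ] ⊖ N[ v ] → ∣ N[ u ] ⊖ N[ v ] ∣ ≡ 2 → VertexCondition G x
    two-differences⇒VertexCondition {u} {v} u≢v 2≤∣N[u]∣ 2≤∣N[v]∣ x∈D ∣D∣≡2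
      with T? (Graph.adj G u v) | x∈p⊖q⁻ N[ u ] N[ v ] x∈D
    ... | yes uv | inj₁ (x∈N[u] , x∉N[v]) = adjacent-pair uv x∈N[u] x∉N[v] ∣D∣≡2
    ... | yes uv | inj₂ (x∈N[v] , x∉N[u]) =
      adjacent-pair (Adj-sym uv) x∈N[v] x∉N[u] (trans (cong ∣_∣ (⊖-comm N[ v ] N[ u ])) ∣D∣≡2)
    ... | no ¬uv | _ with nonadjacent-difference ¬uv u≢v ∣D∣≡2 x∈D
    ...   | inj₁ refl = inj₁ (nonadjacent-pair-leaf ¬uv u≢v 2≤∣N[u]∣ ∣D∣≡2)
    ...   | inj₂ refl = inj₁ (nonadjacent-pair-leaf (¬uv ∘ Adj-sym) (u≢v ∘ sym) 2≤∣N[v]∣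
                                (trans (cong ∣_∣ (⊖-comm N[ v ] N[ u ])) ∣D∣≡2))

    separated-or-VertexCondition : IsRedIC ⊤ → ∀ u v →
      (u ≢ v → 2 ≤ ∣ (N[ u ] ⊖ N[ v ]) - x ∣) ⊎ VertexCondition G x
    separated-or-VertexCondition {x} ⊤-code u v with IsRedIC-⊤⁻ ⊤-code | u ≟ v
    ... | _ | yes refl = inj₁ (λ u≢u → contradiction refl u≢u)
    ... | dominated , separated | no u≢v with x ∈? N[ u ] ⊖ N[ v ]
    ...   | no x∉D  = inj₁ (λ _ → ≤-trans (separated u v u≢v) (p⊆q⇒∣p∣≤∣q∣ (x∉p⇒p⊆q-x x∉D ⊆-refl)))
    ...   | yes x∈D = Sum.map (λ 2≤∣D-x∣ _ → 2≤∣D-x∣)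
                              (two-differences⇒VertexCondition u≢v (dominated u) (dominated v) x∈D)
                              (2≤∣p-x∣⊎∣p∣≡2 x∈D (separated u v u≢v))

    ¬IsRedIC[⊤-x]⇒VertexCondition : IsRedIC ⊤ → ¬ IsRedIC (⊤ - x) → VertexCondition G x
    ¬IsRedIC[⊤-x]⇒VertexCondition {x} ⊤-code ¬code
      with ∀[P⊎Q]⇒∀P⊎Q (λ w → dominated-or-VertexCondition (proj₁ (IsRedIC-⊤⁻ ⊤-code) w))
         | ∀[P⊎Q]⇒∀P⊎Q (λ u → ∀[P⊎Q]⇒∀P⊎Q (separated-or-VertexCondition ⊤-code u))
    ... | inj₂ vc        | _              = vc
    ... | inj₁ _         | inj₂ vc        = vc
    ... | inj₁ dominated | inj₁ separated =
      contradiction (Equivalence.from IsRedIC[⊤-x]⇔ (dominated , separated)) ¬code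

theorem6 : (n : ℕ) → 4 ≤ n → (G : Graph n) → IsTree G → HasRedIC G →
    (REDIC≡ G n → (v : Fin n) → VertexCondition G v) ×
    (((v : Fin n) → VertexCondition G v) → REDIC≡ G n)
theorem6 n _ G (_ , acyclic) (S , S-code) =
  (λ minimum v → ¬IsRedIC[⊤-x]⇒VertexCondition G acyclic ⊤-code (Equivalence.to irremovable⇔ minimum v)) ,
  (λ conditions → Equivalence.from irremovable⇔ (λ v → VertexCondition⇒¬IsRedIC[⊤-x] G (conditions v)))
  where
  ⊤-code : D.IsRedIC G ⊤
  ⊤-code = IsRedIC-mono G ⊆⊤ S-code
  irremovable⇔ : REDIC≡ G n ⇔ (∀ x → ¬ D.IsRedIC G (⊤ - x))
  irremovable⇔ = REDIC≡n⇔∀¬IsRedIC[⊤-x] G ⊤-code
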